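{- Consider the mirror game on $\{1,\ldots,2n\}$ against an arbitrary open-book strategy of Alice, and let $k$ be an integer with $1\le k\le n$. Suppose that on each of his turns $2,4,\ldots,2k$ Bob chooses, uniformly at random using his own coins $R_B$, a number that has not been picked so far. Let $S$ denote the set of numbers picked during the first $2k$ turns. Then for every subset $s\subseteq\{1,\ldots,2n\}$ with $|s|=2k$ and every assignment $r_A$ of Alice's random bits, $$\Pr_{R_B}[S=s\mid R_A=r_A]\le\left(\frac{2k}{2n}\right)^k .$$
   Context: Mirror game: Alice and Bob alternately name numbers from $\{1,2,\ldots,2n\}$, Alice on odd turns $1,3,\ldots$ and Bob on even turns $2,4,\ldots$. A player who names a number that was named before loses; if all $2n$ turns pass without repetition the game is a draw. Open-book Alice: she has a memory state $x\in\{0,1\}^m$; at the end of each turn $2i$ she draws a fresh random string $r_i$ (of arbitrary length), and from then on has access to all of $R_A^i=(r_1,\ldots,r_i)$. Her strategy consists of a next-move function giving her move from her current memory state and the random strings drawn so far, and a state-transition function giving her new memory state from Bob's last move, her current memory state, the turn number, and the random strings drawn so far. Bob knows both functions, and at every moment knows Alice's current memory state and all random strings she has drawn so far, but not her future random strings. $R_A$ denotes Alice's random strings and $R_B$ Bob's random bits; probabilities $\Pr_{R_B}[\cdot\mid R_A=r_A]$ are over Bob's coins with Alice's random strings fixed to $r_A$. -}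

module Defs where

open import Data.Nat as ℕ using (ℕ; zero; suc; _*_)
open import Data.Integer using (+_)
open import Data.Rational using (ℚ; 0ℚ; 1ℚ; _/_; _+_) renaming (_*_ to _*ℚ_)
open import Data.Bool using (Bool; if_then_else_)
import Data.Bool.Properties as BoolP
open import Data.Fin using (Fin)
import Data.Fin.Properties as FinP
open import Data.Fin.Subset using (Subset; ⁅_⁆; _∪_; ⊥)
open import Data.List using (List; []; _∷_; map; foldr; filter; upTo; allFin)
open import Data.Vec using (Vec)
open import Data.Vec.Properties using (≡-dec)
open import Relation.Nullary using (does; ¬?)

-- Positions 1..2n of the paper are represented by Fin (2 * n) (0-based).

-- Random strings are arbitrary-length bit strings (List Bool); the list of
-- random strings drawn so far R^i = (r_1,...,r_i) is a List (List Bool).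
record OpenBookAlice (n m : ℕ) : Set where
  field
    initState  : Vec Bool m
    nextMove   : Vec Bool m → List (List Bool) → Fin (2 * n)
    -- state-transition: Bob's last move, current state, turn number,
    -- random strings so far ↦ new memory state
    transition : Fin (2 * n) → Vec Bool m → ℕ → List (List Bool) → Vec Bool m

open OpenBookAlice public

-- Alice's random strings, fixed: rA i is the string r_{i+1}.
-- R^i = (r_1,...,r_i)
RA : (ℕ → List Bool) → ℕ → List (List Bool)
RA rA i = map rA (upTo i)

toSubset : ∀ {N} → List (Fin N) → Subset N
toSubset = foldr (λ a s → ⁅ a ⁆ ∪ s) ⊥

indicator : ∀ {N} → List (Fin N) → Subset N → ℚ
indicator used s = if does (≡-dec BoolP._≟_ (toSubset used) s) then 1ℚ else 0ℚ

sumℚ : List ℚ → ℚ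
sumℚ = foldr _+_ 0ℚ

module _ {n m : ℕ} (A : OpenBookAlice n m) (rA : ℕ → List Bool) (s : Subset (2 * n)) where
  open import Data.List.Membership.DecPropositional (FinP._≟_ {n = 2 * n}) using (_∈?_)

  -- go r i used x : probability (over Bob's coins) that the set of numbers
  -- picked when the game has run r more rounds (or ended earlier because of a
  -- repetition) equals s, starting after i completed rounds (2i turns),
  -- numbers already picked `used`, Alice's memory state x.
  go : ℕ → ℕ → List (Fin (2 * n)) → Vec Bool m → ℚ
  go zero i used x = indicator used s
  go (suc r) i used x with does (nextMove A x (RA rA i) ∈? used)
  ... | Data.Bool.true = indicator used s   -- Alice repeats: game over
  ... | Data.Bool.false = bobTurn (filter (λ b → ¬? (b ∈? used′)) (allFin (2 * n)))
    where
      used′ = nextMove A x (RA rA i) ∷ used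
      -- Bob picks uniformly among the numbers not picked so far;
      -- after Bob's move on turn 2(i+1), Alice draws r_{i+1} and updates her state.
      bobTurn : List (Fin (2 * n)) → ℚ
      bobTurn [] = indicator used′ s
      bobTurn avail@(b ∷ bs) =
        (+ 1 / Data.List.length avail) *ℚ
        sumℚ (map (λ b′ → go r (suc i) (b′ ∷ used′)
                            (transition A b′ x (2 * suc i) (RA rA (suc i))))
                  avail)

probS : ∀ {n m} → OpenBookAlice n m → (ℕ → List Bool) → ℕ → Subset (2 * n) → ℚ
probS A rA k s = go A rA s k 0 [] (initState A)

_^ℚ_ : ℚ → ℕ → ℚ
q ^ℚ zero = 1ℚ
q ^ℚ suc e = q *ℚ (q ^ℚ e)

-- (2k / 2n)^k  (n = 0 never occurs under 1 ≤ k ≤ n)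
bound : ℕ → ℕ → ℚ
bound k zero = 0ℚ
bound k (suc n′) = (+ (2 * k) / (2 * suc n′)) ^ℚ k

{-# OPTIONS --safe #-}
module Submission where

-- While every number named so far
-- lies in s, all 2n − |s| numbers outside s are still available to Bob, and at most |s| available
-- numbers lie in s; so Bob's uniform pick stays in s with probability at most |s|/2n, and a pick
-- outside s makes S = s impossible. Hence, with r rounds left and at least 2r numbers of s still
-- unnamed, the probability of ending with S = s is at most (|s|/2n)^r, by induction on r.

open import Defs
open import Level using (Level)
open import Function using (id; _∘_)
open import Function.Bundles using (_⇔_; mk⇔; Equivalence)
open import Data.Nat using (ℕ; zero; suc; _+_; _*_; _≤_; _<_; s≤s)
import Data.Nat.Properties as ℕ
open import Data.Nat.Tactic.RingSolver using (solve-∀)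
open import Data.Integer as ℤ using (+_)
import Data.Integer.Properties as ℤ
import Data.Rational as ℚ
open import Data.Rational using (ℚ; 0ℚ; 1ℚ; _/_; NonNegative)
  renaming (_+_ to _+ℚ_; _*_ to _*ℚ_)
import Data.Rational.Properties as ℚ
open import Data.Rational.Unnormalised as ℚᵘ using (mkℚᵘ; *≤*; *≡*)
import Data.Rational.Unnormalised.Properties as ℚᵘ
open import Data.Bool using (Bool; true; false)
import Data.Bool.Properties as Bool
open import Data.Fin using (Fin)
import Data.Fin.Properties as Fin
open import Data.Fin.Subset using (Subset; ∣_∣; ⁅_⁆; _∪_; ⊥; _∈_; _∉_; _⊈_; inside; outside)
open import Data.Fin.Subset.Properties
  using (_∈?_; x∈p∪q⁺; x∈⁅x⁆; ∣⁅x⁆∣≡1; ∣⊥∣≡0; drop-there)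
open import Data.Vec using (Vec; []; _∷_; here; there)
open import Data.Vec.Properties using (≡-dec)
open import Data.List using (List; []; _∷_; length; filter; map; tabulate; allFin)
import Data.List.Properties as List
open import Data.List.Relation.Unary.Any as Any using (Any)
open import Data.List.Relation.Unary.All as All using (All)
open import Data.List.Relation.Unary.All.Properties using (¬All⇒Any¬)
open import Data.Sum using (inj₁; inj₂)
open import Algebra.Bundles using (CommutativeMonoid)
open import Algebra.Properties.CommutativeSemigroup
  (CommutativeMonoid.commutativeSemigroup ℚ.*-1-commutativeMonoid) using (x∙yz≈y∙xz)
open import Relation.Nullary using (¬_; yes; no; does; ¬?; contradiction)
open import Relation.Unary using (Pred; Decidable; ∁) renaming (_⊆_ to _⇒_)
open import Relation.Unary.Properties using (∁?)
open import Relation.Binary.PropositionalEquality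
  using (_≡_; refl; sym; trans; cong; cong₂; subst; subst₂; _≢_; module ≡-Reasoning)

private
  variable
    a ℓ : Level
    A : Set a

fromℕ : ℕ → ℚ
fromℕ c = + c / 1

toℚᵘ-/ : ∀ i d → ℚ.toℚᵘ (i / suc d) ℚᵘ.≃ mkℚᵘ i d
toℚᵘ-/ i d = ℚ.toℚᵘ-fromℚᵘ (mkℚᵘ i d)

fromℕ-suc : ∀ c → fromℕ (suc c) ≡ 1ℚ +ℚ fromℕ c
fromℕ-suc c = ℚ.toℚᵘ-injective (begin-equality
  ℚ.toℚᵘ (fromℕ (suc c))            ≃⟨ toℚᵘ-/ (+ suc c) 0 ⟩
  mkℚᵘ (+ suc c) 0                   ≃⟨ *≡* eq ⟩
  mkℚᵘ (+ 1) 0 ℚᵘ.+ mkℚᵘ (+ c) 0     ≃⟨ ℚᵘ.+-congʳ (mkℚᵘ (+ 1) 0) (toℚᵘ-/ (+ c) 0) ⟨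
  ℚ.toℚᵘ 1ℚ ℚᵘ.+ ℚ.toℚᵘ (fromℕ c)    ≃⟨ ℚ.toℚᵘ-homo-+ 1ℚ (fromℕ c) ⟨
  ℚ.toℚᵘ (1ℚ +ℚ fromℕ c)            ∎)
  where
  open ℚᵘ.≤-Reasoning
  eq : + suc c ℤ.* + 1 ≡ (+ 1 ℤ.* + 1 ℤ.+ + c ℤ.* + 1) ℤ.* + 1
  eq = cong (ℤ._* + 1) (cong (ℤ._+_ (+ 1)) (sym (ℤ.*-identityʳ (+ c))))

1/*fromℕ : ∀ l c → (+ 1 / suc l) *ℚ fromℕ c ≡ + c / suc l
1/*fromℕ l c = ℚ.toℚᵘ-injective (begin-equality
  ℚ.toℚᵘ ((+ 1 / suc l) *ℚ fromℕ c)
    ≃⟨ ℚ.toℚᵘ-homo-* (+ 1 / suc l) (fromℕ c) ⟩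
  ℚ.toℚᵘ (+ 1 / suc l) ℚᵘ.* ℚ.toℚᵘ (fromℕ c)
    ≃⟨ ℚᵘ.*-cong (toℚᵘ-/ (+ 1) l) (toℚᵘ-/ (+ c) 0) ⟩
  mkℚᵘ (+ 1) l ℚᵘ.* mkℚᵘ (+ c) 0
    ≃⟨ *≡* eq ⟩
  mkℚᵘ (+ c) l
    ≃⟨ toℚᵘ-/ (+ c) l ⟨
  ℚ.toℚᵘ (+ c / suc l)
    ∎)
  where
  open ℚᵘ.≤-Reasoning
  eq : (+ 1 ℤ.* + c) ℤ.* + suc l ≡ + c ℤ.* + suc (l * 1)
  eq = cong₂ ℤ._*_ (ℤ.*-identityˡ (+ c)) (cong (λ d → + suc d) (sym (ℕ.*-identityʳ l)))

/-mono-≤ : ∀ a b c d → a * suc d ≤ c * suc b → + a / suc b ℚ.≤ + c / suc d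
/-mono-≤ a b c d le = ℚ.toℚᵘ-cancel-≤
  (ℚᵘ.≤-respˡ-≃ (ℚᵘ.≃-sym (toℚᵘ-/ (+ a) b))
    (ℚᵘ.≤-respʳ-≃ (ℚᵘ.≃-sym (toℚᵘ-/ (+ c) d))
      (*≤* (subst₂ ℤ._≤_ (ℤ.pos-* a (suc d)) (ℤ.pos-* c (suc b)) (ℤ.+≤+ le)))))

^ℚ-nonNeg : ∀ p .{{_ : NonNegative p}} r → NonNegative (p ^ℚ r)
^ℚ-nonNeg p zero    = ℚ.normalize-nonNeg 1 1
^ℚ-nonNeg p (suc r) = ℚ.nonNeg*nonNeg⇒nonNeg p (p ^ℚ r) {{^ℚ-nonNeg p r}}

indicator-≢ : ∀ {n} (l : List (Fin n)) (p : Subset n) → toSubset l ≢ p → indicator l p ≡ 0ℚ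
indicator-≢ l p ≢p with ≡-dec Bool._≟_ (toSubset l) p
... | yes ≡p = contradiction ≡p ≢p
... | no _   = refl

indicator≤1 : ∀ {n} (l : List (Fin n)) (p : Subset n) → indicator l p ℚ.≤ 1ℚ
indicator≤1 l p with ≡-dec Bool._≟_ (toSubset l) p
... | yes _ = ℚ.≤-refl
... | no _  = ℚ.nonNegative⁻¹ 1ℚ {{ℚ.normalize-nonNeg 1 1}}

∣p∪q∣≤∣p∣+∣q∣ : ∀ {n} (p q : Subset n) → ∣ p ∪ q ∣ ≤ ∣ p ∣ + ∣ q ∣
∣p∪q∣≤∣p∣+∣q∣ []            []            = ℕ.≤-refl
∣p∪q∣≤∣p∣+∣q∣ (outside ∷ p) (outside ∷ q) = ∣p∪q∣≤∣p∣+∣q∣ p q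
∣p∪q∣≤∣p∣+∣q∣ (outside ∷ p) (inside  ∷ q) =
  subst (suc ∣ p ∪ q ∣ ≤_) (sym (ℕ.+-suc ∣ p ∣ ∣ q ∣)) (s≤s (∣p∪q∣≤∣p∣+∣q∣ p q))
∣p∪q∣≤∣p∣+∣q∣ (inside  ∷ p) (outside ∷ q) = s≤s (∣p∪q∣≤∣p∣+∣q∣ p q)
∣p∪q∣≤∣p∣+∣q∣ (inside  ∷ p) (inside  ∷ q) =
  s≤s (ℕ.≤-trans (∣p∪q∣≤∣p∣+∣q∣ p q) (ℕ.+-monoʳ-≤ ∣ p ∣ (ℕ.n≤1+n ∣ q ∣)))

∣toSubset∣≤length : ∀ {n} (l : List (Fin n)) → ∣ toSubset l ∣ ≤ length l
∣toSubset∣≤length {n} []      = ℕ.≤-reflexive (∣⊥∣≡0 n)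
∣toSubset∣≤length     (x ∷ l) = begin
  ∣ ⁅ x ⁆ ∪ toSubset l ∣         ≤⟨ ∣p∪q∣≤∣p∣+∣q∣ ⁅ x ⁆ (toSubset l) ⟩
  (∣ ⁅ x ⁆ ∣ + ∣ toSubset l ∣)   ≡⟨ cong (_+ ∣ toSubset l ∣) (∣⁅x⁆∣≡1 x) ⟩
  suc ∣ toSubset l ∣             ≤⟨ s≤s (∣toSubset∣≤length l) ⟩
  suc (length l)                 ∎
  where open ℕ.≤-Reasoning

toSubset-⊈ : ∀ {n} {l : List (Fin n)} {p : Subset n} → Any (_∉ p) l → toSubset l ⊈ p
toSubset-⊈ (Any.here  {x} x∉p) ⊆p = x∉p (⊆p (x∈p∪q⁺ (inj₁ (x∈⁅x⁆ x))))
toSubset-⊈ (Any.there out)      ⊆p = toSubset-⊈ out (⊆p ∘ x∈p∪q⁺ ∘ inj₂)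

toSubset-≢ : ∀ {n} {l : List (Fin n)} {p : Subset n} → Any (_∉ p) l → toSubset l ≢ p
toSubset-≢ out refl = toSubset-⊈ out id

toSubset-short : ∀ {n} (l : List (Fin n)) {p : Subset n} → length l < ∣ p ∣ → toSubset l ≢ p
toSubset-short l lt refl = ℕ.<⇒≱ lt (∣toSubset∣≤length l)

indicator-short : ∀ {n} (l : List (Fin n)) {p : Subset n} → length l < ∣ p ∣ → indicator l p ≡ 0ℚ
indicator-short l {p} lt = indicator-≢ l p (toSubset-short l lt)

m+2[1+n]≤o⇒2+m+2n≤o : ∀ {m n o} → m + 2 * suc n ≤ o → 2 + m + 2 * n ≤ o
m+2[1+n]≤o⇒2+m+2n≤o {m} {n} {o} = subst (_≤ o) (m+2[1+n]≡2+m+2n m n)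
  where
  m+2[1+n]≡2+m+2n : ∀ m n → m + 2 * suc n ≡ 2 + m + 2 * n
  m+2[1+n]≡2+m+2n = solve-∀

m+2[1+n]≤o⇒1+m<o : ∀ {m n o} → m + 2 * suc n ≤ o → suc m < o
m+2[1+n]≤o⇒1+m<o le = ℕ.≤-trans (ℕ.m≤m+n _ _) (m+2[1+n]≤o⇒2+m+2n≤o le)

⇔-there : ∀ {B : Set ℓ} {n b} {i : Fin n} {p : Subset n} → B ⇔ Fin.suc i ∈ (b ∷ p) → B ⇔ i ∈ p
⇔-there B⇔ = mk⇔ (drop-there ∘ Equivalence.to B⇔) (Equivalence.from B⇔ ∘ there)

module _ {P : Pred A ℓ} (P? : Decidable P) where

  length-filter+length-filter-∁ : ∀ xs →
    length (filter P? xs) + length (filter (∁? P?) xs) ≡ length xs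
  length-filter+length-filter-∁ []       = refl
  length-filter+length-filter-∁ (x ∷ xs) with ih ← length-filter+length-filter-∁ xs | does (P? x)
  ... | true  = cong suc ih
  ... | false = trans (ℕ.+-suc _ _) (cong suc ih)

  filter-filter-⇒ : ∀ {q} {Q : Pred A q} (Q? : Decidable Q) → Q ⇒ P →
                    ∀ xs → filter Q? (filter P? xs) ≡ filter Q? xs
  filter-filter-⇒ Q? Q⇒P []       = refl
  filter-filter-⇒ Q? Q⇒P (x ∷ xs) with P? x
  ... | yes _ with does (Q? x)
  ...   | true  = cong (x ∷_) (filter-filter-⇒ Q? Q⇒P xs)
  ...   | false = filter-filter-⇒ Q? Q⇒P xs
  filter-filter-⇒ Q? Q⇒P (x ∷ xs) | no ¬Px =
    trans (filter-filter-⇒ Q? Q⇒P xs) (sym (List.filter-reject Q? (¬Px ∘ Q⇒P)))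

  length-filter-tabulate : ∀ {n} (f : Fin n → A) (p : Subset n) → (∀ i → P (f i) ⇔ i ∈ p) →
    length (filter P? (tabulate f)) ≡ ∣ p ∣
  length-filter-tabulate f []      _    = refl
  length-filter-tabulate f (x ∷ p) P⇔∈
    with ih ← length-filter-tabulate (f ∘ Fin.suc) p (λ i → ⇔-there (P⇔∈ (Fin.suc i))) | P? (f Fin.zero) | x
  ... | yes _   | inside  = cong suc ih
  ... | yes Pf0 | outside = contradiction (Equivalence.to (P⇔∈ Fin.zero) Pf0) λ ()
  ... | no ¬Pf0 | inside  = contradiction (Equivalence.from (P⇔∈ Fin.zero) here) ¬Pf0
  ... | no _    | outside = ih

m≤n⇒m*[n+o]≤n*[m+o] : ∀ {m n} o → m ≤ n → m * (n + o) ≤ n * (m + o)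
m≤n⇒m*[n+o]≤n*[m+o] {m} {n} o m≤n = begin
  m * (n + o)      ≡⟨ ℕ.*-distribˡ-+ m n o ⟩
  m * n + m * o    ≤⟨ ℕ.+-monoʳ-≤ (m * n) (ℕ.*-monoˡ-≤ o m≤n) ⟩
  m * n + n * o    ≡⟨ cong (_+ n * o) (ℕ.*-comm m n) ⟩
  n * m + n * o    ≡⟨ ℕ.*-distribˡ-+ n m o ⟨
  n * (m + o)      ∎
  where open ℕ.≤-Reasoning

length-filter-∈?-allFin : ∀ {n} (p : Subset n) → length (filter (_∈? p) (allFin n)) ≡ ∣ p ∣
length-filter-∈?-allFin p = length-filter-tabulate (_∈? p) id p (λ _ → mk⇔ id id)

length-filter-∈?-available : ∀ {n} (p : Subset n) {P : Pred (Fin n) ℓ} (P? : Decidable P) → ∁ (_∈ p) ⇒ P →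
  let avail = filter P? (allFin n) in length (filter (_∈? p) avail) * n ≤ ∣ p ∣ * length avail
length-filter-∈?-available {n = n} p P? ∉p⇒P =
  subst₂ (λ k l → c * k ≤ ∣ p ∣ * l) (sym n≡∣p∣+d) (sym avail≡c+d)
    (m≤n⇒m*[n+o]≤n*[m+o] d c≤∣p∣)
  where
  all = allFin n
  avail = filter P? all
  c = length (filter (_∈? p) avail)
  d = length (filter (∁? (_∈? p)) all)
  n≡∣p∣+d : n ≡ ∣ p ∣ + d
  n≡∣p∣+d = begin
    n                                          ≡⟨ List.length-tabulate id ⟨
    length all                                 ≡⟨ length-filter+length-filter-∁ (_∈? p) all ⟨
    length (filter (_∈? p) all) + d            ≡⟨ cong (_+ d) (length-filter-∈?-allFin p) ⟩
    ∣ p ∣ + d                                  ∎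
    where open ≡-Reasoning
  avail≡c+d : length avail ≡ c + d
  avail≡c+d = begin
    length avail
      ≡⟨ length-filter+length-filter-∁ (_∈? p) avail ⟨
    c + length (filter (∁? (_∈? p)) avail)
      ≡⟨ cong (λ l → c + length l) (filter-filter-⇒ P? (∁? (_∈? p)) ∉p⇒P all) ⟩
    c + d
      ∎
    where open ≡-Reasoning
  c≤∣p∣ : c ≤ ∣ p ∣
  c≤∣p∣ = ℕ.+-cancelʳ-≤ d c ∣ p ∣ (subst₂ _≤_ avail≡c+d n≡∣p∣+d
    (subst (length avail ≤_) (List.length-tabulate id) (List.length-filter P? all)))

sumℚ-map-zero : (g : A → ℚ) → (∀ x → g x ≡ 0ℚ) → ∀ xs → sumℚ (map g xs) ≡ 0ℚ
sumℚ-map-zero g g≡0 []       = refl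
sumℚ-map-zero g g≡0 (x ∷ xs) = cong₂ _+ℚ_ (g≡0 x) (sumℚ-map-zero g g≡0 xs)

average-zero : (g : A → ℚ) → (∀ x → g x ≡ 0ℚ) →
  ∀ x xs → (+ 1 / length (x ∷ xs)) *ℚ sumℚ (map g (x ∷ xs)) ≡ 0ℚ
average-zero g g≡0 x xs = begin
  1/L *ℚ sumℚ (map g (x ∷ xs))  ≡⟨ cong (1/L *ℚ_) (sumℚ-map-zero g g≡0 (x ∷ xs)) ⟩
  1/L *ℚ 0ℚ                     ≡⟨ ℚ.*-zeroʳ 1/L ⟩
  0ℚ                            ∎
  where
  open ≡-Reasoning
  1/L = + 1 / length (x ∷ xs)

module _ {P : Pred A ℓ} (P? : Decidable P) (g : A → ℚ) (y : ℚ)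
         (g≤y : ∀ x → P x → g x ℚ.≤ y) (g≡0 : ∀ x → ¬ P x → g x ≡ 0ℚ) where

  sumℚ-map-≤-count : ∀ xs → sumℚ (map g xs) ℚ.≤ y *ℚ fromℕ (length (filter P? xs))
  sumℚ-map-≤-count []       = ℚ.≤-reflexive (sym (ℚ.*-zeroʳ y))
  sumℚ-map-≤-count (x ∷ xs) with P? x
  ... | yes Px = begin
    g x +ℚ sumℚ (map g xs)      ≤⟨ ℚ.+-mono-≤ (g≤y x Px) (sumℚ-map-≤-count xs) ⟩
    y +ℚ y *ℚ fromℕ c           ≡⟨ cong (_+ℚ y *ℚ fromℕ c) (ℚ.*-identityʳ y) ⟨
    y *ℚ 1ℚ +ℚ y *ℚ fromℕ c     ≡⟨ ℚ.*-distribˡ-+ y 1ℚ (fromℕ c) ⟨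
    y *ℚ (1ℚ +ℚ fromℕ c)        ≡⟨ cong (y *ℚ_) (fromℕ-suc c) ⟨
    y *ℚ fromℕ (suc c)          ∎
    where
    open ℚ.≤-Reasoning
    c = length (filter P? xs)
  ... | no ¬Px = begin
    g x +ℚ sumℚ (map g xs)      ≡⟨ cong (_+ℚ sumℚ (map g xs)) (g≡0 x ¬Px) ⟩
    0ℚ +ℚ sumℚ (map g xs)       ≡⟨ ℚ.+-identityˡ _ ⟩
    sumℚ (map g xs)             ≤⟨ sumℚ-map-≤-count xs ⟩
    y *ℚ fromℕ (length (filter P? xs)) ∎
    where open ℚ.≤-Reasoning

  average-≤ : .{{_ : NonNegative y}} (k d : ℕ) (x : A) (xs : List A) →
    length (filter P? (x ∷ xs)) * suc d ≤ k * length (x ∷ xs) →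
    (+ 1 / length (x ∷ xs)) *ℚ sumℚ (map g (x ∷ xs)) ℚ.≤ (+ k / suc d) *ℚ y
  average-≤ k d x xs count≤ = begin
    1/L *ℚ sumℚ (map g (x ∷ xs))     ≤⟨ ℚ.*-monoˡ-≤-nonNeg 1/L {{ℚ.normalize-nonNeg 1 (suc L)}}
                                          (sumℚ-map-≤-count (x ∷ xs)) ⟩
    1/L *ℚ (y *ℚ fromℕ c)            ≡⟨ x∙yz≈y∙xz 1/L y (fromℕ c) ⟩
    y *ℚ (1/L *ℚ fromℕ c)            ≡⟨ cong (y *ℚ_) (1/*fromℕ L c) ⟩
    y *ℚ (+ c / suc L)               ≤⟨ ℚ.*-monoˡ-≤-nonNeg y (/-mono-≤ c L k d count≤) ⟩
    y *ℚ (+ k / suc d)               ≡⟨ ℚ.*-comm y (+ k / suc d) ⟩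
    (+ k / suc d) *ℚ y               ∎
    where
    open ℚ.≤-Reasoning
    L = length xs
    c = length (filter P? (x ∷ xs))
    1/L = + 1 / suc L

module _ {n′ m : ℕ} (A : OpenBookAlice (suc n′) m) (rA : ℕ → List Bool) (s : Subset (2 * suc n′)) where

  private
    N = 2 * suc n′

  open import Data.List.Membership.DecPropositional (Fin._≟_ {n = N})
    using () renaming (_∉_ to _∉ˡ_; _∈?_ to _∈ˡ?_)

  alice : Vec Bool m → ℕ → Fin N
  alice st i = nextMove A st (RA rA i)

  afterBob : ℕ → ℕ → List (Fin N) → Vec Bool m → Fin N → ℚ
  afterBob r i used st b = go A rA s r (suc i) (b ∷ used) (transition A b st (2 * suc i) (RA rA (suc i)))

  go-outside : ∀ r i used st → Any (_∉ s) used → go A rA s r i used st ≡ 0ℚ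
  go-outside zero    i used st out = indicator-≢ used s (toSubset-≢ out)
  go-outside (suc r) i used st out with does (alice st i ∈ˡ? used)
  ... | true  = indicator-≢ used s (toSubset-≢ out)
  ... | false with filter (λ b → ¬? (b ∈ˡ? (alice st i ∷ used))) (allFin N)
  ...   | []     = indicator-≢ (alice st i ∷ used) s (toSubset-≢ (Any.there out))
  ...   | b ∷ bs = average-zero (afterBob r i (alice st i ∷ used) st)
    (λ b′ → go-outside r (suc i) (b′ ∷ alice st i ∷ used) _ (Any.there (Any.there out))) b bs

  q : ℚ
  q = + ∣ s ∣ / N

  q^-nonNeg : ∀ r → NonNegative (q ^ℚ r)
  q^-nonNeg = ^ℚ-nonNeg q {{ℚ.normalize-nonNeg ∣ s ∣ N}}

  ≡0⇒≤q^ : ∀ {p} r → p ≡ 0ℚ → p ℚ.≤ q ^ℚ r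
  ≡0⇒≤q^ r refl = ℚ.nonNegative⁻¹ (q ^ℚ r) {{q^-nonNeg r}}

  go-bound : ∀ r i used st → length used + 2 * r ≤ ∣ s ∣ → go A rA s r i used st ℚ.≤ q ^ℚ r
  go-bound zero    i used st _    = indicator≤1 used s
  go-bound (suc r) i used st room with does (alice st i ∈ˡ? used)
  ... | true  = ≡0⇒≤q^ (suc r) (indicator-short used (ℕ.<-trans (ℕ.n<1+n _) (m+2[1+n]≤o⇒1+m<o room)))
  ... | false with filter (λ b → ¬? (b ∈ˡ? (alice st i ∷ used))) (allFin N) in avail≡
  ...   | []     = ≡0⇒≤q^ (suc r) (indicator-short (alice st i ∷ used) (m+2[1+n]≤o⇒1+m<o room))
  ...   | b ∷ bs with All.all? (_∈? s) (alice st i ∷ used)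
  ...     | no used⊈s = ≡0⇒≤q^ (suc r) (average-zero (afterBob r i (alice st i ∷ used) st)
    (λ b′ → go-outside r (suc i) _ _ (Any.there (¬All⇒Any¬ (_∈? s) _ used⊈s))) b bs)
  ...     | yes used⊆s =
    average-≤ (_∈? s) (afterBob r i used′ st) (q ^ℚ r) inside-≤ outside-≡0 {{q^-nonNeg r}} ∣ s ∣ _ b bs
      (subst (λ avail → length (filter (_∈? s) avail) * N ≤ ∣ s ∣ * length avail) avail≡
        (length-filter-∈?-available s (λ b → ¬? (b ∈ˡ? used′)) outside-available))
    where
    used′ = alice st i ∷ used
    inside-≤ : ∀ b′ → b′ ∈ s → afterBob r i used′ st b′ ℚ.≤ q ^ℚ r
    inside-≤ b′ _ = go-bound r (suc i) (b′ ∷ used′) _ (m+2[1+n]≤o⇒2+m+2n≤o room)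
    outside-≡0 : ∀ b′ → b′ ∉ s → afterBob r i used′ st b′ ≡ 0ℚ
    outside-≡0 b′ b′∉s = go-outside r (suc i) (b′ ∷ used′) _ (Any.here b′∉s)
    outside-available : ∀ {b} → b ∉ s → b ∉ˡ used′
    outside-available b∉s b∈used′ = b∉s (All.lookup used⊆s b∈used′)

claim4p1 : (n m k : ℕ) (A : OpenBookAlice n m) (rA : ℕ → List Bool)
    (s : Subset (2 * n)) → 1 ≤ k → k ≤ n → ∣ s ∣ ≡ 2 * k →
    probS A rA k s ℚ.≤ bound k n
claim4p1 zero     m k A rA s 1≤k k≤0 _ = contradiction (ℕ.≤-trans 1≤k k≤0) λ ()
claim4p1 (suc n′) m k A rA s _   _   ∣s∣≡2k =
  subst (λ K → probS A rA k s ℚ.≤ (+ K / (2 * suc n′)) ^ℚ k) ∣s∣≡2k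
    (go-bound A rA s k 0 [] (initState A) (ℕ.≤-reflexive (sym ∣s∣≡2k)))
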